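{- Let $\kappa \in \{2,3,4,\ldots,\omega,\omega_1\}$. If a function $g\colon \mathbb{N} \to \mathbb{N}$ has a $\kappa$-fold Diophantine representation, then there exists a positive integer $m$ such that $g(n) < f_{\kappa}(n)$ for every integer $n \geq m$.
   Context: $\mathbb{N}$ denotes the set of non-negative integers; $\omega$ is the least infinite cardinal and $\omega_1$ the least uncountable cardinal. For a positive integer $n$, let $E_n=\{x_k=1,\ x_i+x_j=x_k,\ x_i \cdot x_j=x_k\colon i,j,k \in \{1,\ldots,n\}\}$ (a set of equations in variables $x_1,\ldots,x_n$). A set $\mathcal{M} \subseteq \mathbb{N}^p$ has a $\kappa$-fold Diophantine representation if there is a polynomial $W$ with integer coefficients such that for all $(a_1,\ldots,a_p)\in\mathbb{N}^p$: $(a_1,\ldots,a_p) \in \mathcal{M}$ iff there exist $x_1,\ldots,x_m \in \mathbb{N}$ with $W(a_1,\ldots,a_p,x_1,\ldots,x_m)=0$, and moreover for all $a_1,\ldots,a_p \in \mathbb{N}$ the equation $W(a_1,\ldots,a_p,x_1,\ldots,x_m)=0$ has fewer than $\kappa$ solutions $(x_1,\ldots,x_m)\in\mathbb{N}^m$. A function $g\colon\mathbb{N}\to\mathbb{N}$ has a $\kappa$-fold Diophantine representation if its graph $\{(x,g(x))\colon x\in\mathbb{N}\}\subseteq\mathbb{N}^2$ does. For a positive integer $n$, $f_\kappa(n)$ denotes the smallest non-negative integer $b$ such that for each system $S \subseteq E_n$ which has a solution in non-negative integers $x_1,\ldots,x_n$ and which has fewer than $\kappa$ solutions in non-negative integers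 $x_1,\ldots,x_n$, there exists a solution of $S$ in non-negative integers not greater than $b$. -}

module Defs where

open import Data.Nat using (ℕ; zero; suc; _≤_; _<_; _∸_)
open import Data.Integer as ℤ using (ℤ; +_)
open import Data.Fin using (Fin)
open import Data.Vec using (Vec; []; _∷_; lookup; _++_)
open import Data.List using (List)
open import Data.List.Relation.Unary.All using (All)
open import Data.Product using (Σ; ∃; _×_; _,_)
open import Function.Bundles using (_⇔_)
open import Relation.Binary.PropositionalEquality using (_≡_)

data Kappa : Set where
  fin : (k : ℕ) → 2 ≤ k → Kappa
  ω   : Kappa
  ω₁  : Kappa

InjectsInto : ∀ {m} → (Vec ℕ m → Set) → Set → Set
InjectsInto {m} S B =
  Σ ((x : Vec ℕ m) → S x → B) λ f →
    ∀ x y (p : S x) (q : S y) → f x p ≡ f y q → x ≡ y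

-- |S| < κ  (cardinality of a subset of ℕ^m strictly below κ)
--   |S| < k   iff S injects into a set with k-1 elements
--   |S| < ω   iff S is finite (injects into some Fin j)
--   |S| < ω₁  iff S is countable (injects into ℕ)
FewerThan : ∀ {m} → Kappa → (Vec ℕ m → Set) → Set
FewerThan (fin k _) S = InjectsInto S (Fin (k ∸ 1))
FewerThan ω         S = ∃ λ j → InjectsInto S (Fin j)
FewerThan ω₁        S = InjectsInto S ℕ

data Poly (n : ℕ) : Set where
  con  : ℤ → Poly n
  var  : Fin n → Poly n
  _⊕_  : Poly n → Poly n → Poly n
  _⊗_  : Poly n → Poly n → Poly n

eval : ∀ {n} → Poly n → Vec ℤ n → ℤ
eval (con c) ρ = c
eval (var i) ρ = lookup ρ i
eval (p ⊕ q) ρ = eval p ρ ℤ.+ eval q ρ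
eval (p ⊗ q) ρ = eval p ρ ℤ.* eval q ρ

toℤs : ∀ {n} → Vec ℕ n → Vec ℤ n
toℤs [] = []
toℤs (a ∷ as) = + a ∷ toℤs as


SolW : ∀ {p} {m} → Poly (Data.Nat._+_ p m) → Vec ℕ p → Vec ℕ m → Set
SolW W a x = eval W (toℤs (a ++ x)) ≡ + 0

KappaFoldRep : Kappa → (p : ℕ) → (Vec ℕ p → Set) → Set
KappaFoldRep κ p M =
  Σ ℕ λ m → Σ (Poly (Data.Nat._+_ p m)) λ W →
    (∀ a → M a ⇔ (∃ λ (x : Vec ℕ m) → SolW W a x)) ×
    (∀ a → FewerThan κ (SolW {p} {m} W a))

Graph : (ℕ → ℕ) → Vec ℕ 2 → Set
Graph g (x ∷ y ∷ []) = g x ≡ y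

KappaFoldRepFun : Kappa → (ℕ → ℕ) → Set
KappaFoldRepFun κ g = KappaFoldRep κ 2 (Graph g)

data Eqn (n : ℕ) : Set where
  one : Fin n → Eqn n
  add : Fin n → Fin n → Fin n → Eqn n
  mul : Fin n → Fin n → Fin n → Eqn n

SatEq : ∀ {n} → Eqn n → Vec ℕ n → Set
SatEq (one k)     x = lookup x k ≡ 1
SatEq (add i j k) x = Data.Nat._+_ (lookup x i) (lookup x j) ≡ lookup x k
SatEq (mul i j k) x = Data.Nat._*_ (lookup x i) (lookup x j) ≡ lookup x k

System : ℕ → Set
System n = List (Eqn n)

Sol : ∀ {n} → System n → Vec ℕ n → Set
Sol S x = All (λ e → SatEq e x) S

BoundProp : Kappa → (n : ℕ) → ℕ → Set
BoundProp κ n b =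
  (S : System n) → (∃ λ x → Sol S x) → FewerThan κ (Sol S) →
  ∃ λ x → Sol S x × Data.Vec.Relation.Unary.All.All (_≤ b) x
  where import Data.Vec.Relation.Unary.All

IsF : Kappa → ℕ → ℕ → Set
IsF κ n b = BoundProp κ n b × (∀ b′ → BoundProp κ n b′ → b ≤ b′)

-- A straight-line program built from the instructions x := 1, x := 0, x := y + z and
-- x := y · z is a system in E_k whose solutions are exactly its runs: every
-- equation determines the register it writes from the earlier ones.  Writing
-- W = W⁺ − W⁻ with natural coefficients, for each n we compile n, W⁺(n, y, x̄) and
-- W⁻(n, y, x̄) into such a program with inputs y, x̄, add the single equation
-- W⁺ · 1 = W⁻, and pad with dummy registers x := 1 up to n registers.  Its
-- solutions correspond injectively to the solutions x̄ of W(n, g(n), x̄) = 0, so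
-- there are fewer than κ of them, and each contains the register y + 1 = g(n) + 1.
-- Computing the numeral n in steps of two costs about n / 2 registers, so the
-- program fits into n registers once n is large.
module Submission where

open import Defs
open import Data.Nat using (ℕ; zero; suc; _+_; _*_; _∸_; _≤_; _<_; ⌊_/2⌋; z≤n; s≤s)
open import Data.Nat.Properties
  using (+-cancelˡ-≡; +-identityʳ; *-identityʳ; +-mono-≤; +-monoʳ-≤; *-cancelˡ-≤;
         ≤-trans; ≤-reflexive; m∸n+n≡m; ⌊n/2⌋≤⌈n/2⌉; ⌊n/2⌋+⌈n/2⌉≡n)
open import Data.Nat.Tactic.RingSolver using (solve-∀)
open import Data.Integer as ℤ using (+_; -[1+_])
import Data.Integer.Properties as ℤ
import Data.Integer.Tactic.RingSolver as ℤ
open import Data.Fin using (Fin; zero; suc)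
open import Data.Vec using (Vec; []; _∷_; lookup; head; tail)
import Data.Vec.Relation.Unary.All.Properties as Vec
open import Data.List using ([]; _∷_; map)
open import Data.List.Relation.Unary.All using ([]; _∷_)
open import Data.Product using (Σ; ∃; _×_; _,_; proj₁; proj₂)
open import Function using (id; _∘_)
open import Function.Bundles using (_⇔_; mk⇔; Equivalence)
open import Relation.Binary.PropositionalEquality

InjectsInto-comap : ∀ {a b} {S : Vec ℕ a → Set} {T : Vec ℕ b → Set} {B : Set}
  (h : Vec ℕ a → Vec ℕ b) → (∀ w → S w → T (h w)) →
  (∀ w w′ → S w → S w′ → h w ≡ h w′ → w ≡ w′) →
  InjectsInto T B → InjectsInto S B
InjectsInto-comap h into inj (f , f-inj) =
  (λ w s → f (h w) (into w s)) , λ w w′ s s′ eq → inj w w′ s s′ (f-inj _ _ _ _ eq)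

FewerThan-comap : ∀ κ {a b} {S : Vec ℕ a → Set} {T : Vec ℕ b → Set}
  (h : Vec ℕ a → Vec ℕ b) → (∀ w → S w → T (h w)) →
  (∀ w w′ → S w → S w′ → h w ≡ h w′ → w ≡ w′) →
  FewerThan κ T → FewerThan κ S
FewerThan-comap (fin _ _) h into inj = InjectsInto-comap h into inj
FewerThan-comap ω h into inj (j , T↣j) = j , InjectsInto-comap h into inj T↣j
FewerThan-comap ω₁ h into inj = InjectsInto-comap h into inj

BoundProp⇒≤ : ∀ {κ n b t} → BoundProp κ n b → (S : System n) →
  (∃ λ w → Sol S w) → FewerThan κ (Sol S) →
  (∀ w → Sol S w → ∃ λ j → lookup w j ≡ t) → t ≤ b
BoundProp⇒≤ {b = b} bound S solvable few large with bound S solvable few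
... | w , sol , w≤b with large w sol
...   | j , wⱼ≡t = subst (_≤ b) wⱼ≡t (Vec.lookup⁺ w≤b j)

m+m≤o⇒n+n≤o⇒m+n≤o : ∀ {m n o} → m + m ≤ o → n + n ≤ o → m + n ≤ o
m+m≤o⇒n+n≤o⇒m+n≤o {m} {n} {o} m+m≤o n+n≤o =
  *-cancelˡ-≤ 2 (subst₂ _≤_ (regroup m n) (double o) (+-mono-≤ m+m≤o n+n≤o))
  where
  regroup : ∀ a b → (a + a) + (b + b) ≡ 2 * (a + b)
  regroup = solve-∀
  double : ∀ a → a + a ≡ 2 * a
  double = solve-∀

⌊n/2⌋+⌊n/2⌋≤n : ∀ n → ⌊ n /2⌋ + ⌊ n /2⌋ ≤ n
⌊n/2⌋+⌊n/2⌋≤n n = ≤-trans (+-monoʳ-≤ ⌊ n /2⌋ (⌊n/2⌋≤⌈n/2⌉ n)) (≤-reflexive (⌊n/2⌋+⌈n/2⌉≡n n))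

data Ins (k : ℕ) : Set where
  one nought : Ins k
  add mul    : Fin k → Fin k → Ins k

infixl 5 _▷_

data Prog (i : ℕ) : ℕ → Set where
  start : Prog i i
  _▷_   : ∀ {k} → Prog i k → Ins k → Prog i (suc k)

val : ∀ {k} → Ins k → Vec ℕ k → ℕ
val one       _ = 1
val nought    _ = 0
val (add a b) w = lookup w a + lookup w b
val (mul a b) w = lookup w a * lookup w b

-- The newest register comes first: run p v ends with v.
run : ∀ {i k} → Prog i k → Vec ℕ i → Vec ℕ k
run start   v = v
run (p ▷ c) v = val c (run p v) ∷ run p v

initial : ∀ {i k} → Prog i k → Vec ℕ k → Vec ℕ i
initial start   w       = w
initial (p ▷ _) (_ ∷ w) = initial p w

-- E_k has no equation x = 0, but x + x = x forces it.
equation : ∀ {k} → Ins k → Eqn (suc k)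
equation one       = one zero
equation nought    = add zero zero zero
equation (add a b) = add (suc a) (suc b) zero
equation (mul a b) = mul (suc a) (suc b) zero

weaken : ∀ {k} → Eqn k → Eqn (suc k)
weaken (one a)     = one (suc a)
weaken (add a b c) = add (suc a) (suc b) (suc c)
weaken (mul a b c) = mul (suc a) (suc b) (suc c)

system : ∀ {i k} → Prog i k → System k
system start   = []
system (p ▷ c) = equation c ∷ map weaken (system p)

SatEq-weaken : ∀ {k} (e : Eqn k) {a w} → SatEq (weaken e) (a ∷ w) ≡ SatEq e w
SatEq-weaken (one _)     = refl
SatEq-weaken (add _ _ _) = refl
SatEq-weaken (mul _ _ _) = refl

Sol-weaken⁺ : ∀ {k} (es : System k) {a w} → Sol es w → Sol (map weaken es) (a ∷ w)
Sol-weaken⁺ []       []       = []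
Sol-weaken⁺ (e ∷ es) (s ∷ ss) = subst id (sym (SatEq-weaken e)) s ∷ Sol-weaken⁺ es ss

Sol-weaken⁻ : ∀ {k} (es : System k) {a w} → Sol (map weaken es) (a ∷ w) → Sol es w
Sol-weaken⁻ []       []       = []
Sol-weaken⁻ (e ∷ es) (s ∷ ss) = subst id (SatEq-weaken e) s ∷ Sol-weaken⁻ es ss

SatEq-equation-val : ∀ {k} (c : Ins k) w → SatEq (equation c) (val c w ∷ w)
SatEq-equation-val one       _ = refl
SatEq-equation-val nought    _ = refl
SatEq-equation-val (add _ _) _ = refl
SatEq-equation-val (mul _ _) _ = refl

SatEq-equation⇒val : ∀ {k} (c : Ins k) {a w} → SatEq (equation c) (a ∷ w) → a ≡ val c w
SatEq-equation⇒val one           a≡1   = a≡1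
SatEq-equation⇒val nought    {a} a+a≡a = +-cancelˡ-≡ a a 0 (trans a+a≡a (sym (+-identityʳ a)))
SatEq-equation⇒val (add _ _)     eq    = sym eq
SatEq-equation⇒val (mul _ _)     eq    = sym eq

run-solves : ∀ {i k} (p : Prog i k) v → Sol (system p) (run p v)
run-solves start   v = []
run-solves (p ▷ c) v =
  SatEq-equation-val c (run p v) ∷ Sol-weaken⁺ (system p) (run-solves p v)

solution⇒run : ∀ {i k} (p : Prog i k) {w} → Sol (system p) w → w ≡ run p (initial p w)
solution⇒run start   _ = refl
solution⇒run (p ▷ c) {a ∷ w} (s ∷ ss) =
  cong₂ _∷_ (trans (SatEq-equation⇒val c s) (cong (val c) w≡run)) w≡run
  where
  w≡run : w ≡ run p (initial p w)
  w≡run = solution⇒run p (Sol-weaken⁻ (system p) ss)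

infix 4 _≼[_]_

data _≼[_]_ {i k} (p : Prog i k) : ℕ → ∀ {K} → Prog i K → Set where
  ≼-refl : p ≼[ 0 ] p
  ≼-▷    : ∀ {d K} {q : Prog i K} → p ≼[ d ] q → ∀ c → p ≼[ suc d ] q ▷ c

≼-trans : ∀ {i k K L d e} {p : Prog i k} {q : Prog i K} {r : Prog i L} →
  p ≼[ d ] q → q ≼[ e ] r → p ≼[ e + d ] r
≼-trans p≼q ≼-refl      = p≼q
≼-trans p≼q (≼-▷ q≼r c) = ≼-▷ (≼-trans p≼q q≼r) c

≼-size : ∀ {i k K d} {p : Prog i k} {q : Prog i K} → p ≼[ d ] q → K ≡ d + k
≼-size ≼-refl      = refl
≼-size (≼-▷ p≼q _) = cong suc (≼-size p≼q)

pad : ∀ {i k} d → Prog i k → Prog i (d + k)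
pad zero    p = p
pad (suc d) p = pad d p ▷ one

≼-pad : ∀ {i k} d (p : Prog i k) → p ≼[ d ] pad d p
≼-pad zero    p = ≼-refl
≼-pad (suc d) p = ≼-▷ (≼-pad d p) one

infix 4 _computes_

_computes_ : ∀ {i k} → Prog i k → (Vec ℕ i → ℕ) → Set
p computes f = ∃ λ r → ∀ v → lookup (run p v) r ≡ f v

computes-≼ : ∀ {i k K d f} {p : Prog i k} {q : Prog i K} →
  p ≼[ d ] q → p computes f → q computes f
computes-≼ ≼-refl      p∋f = p∋f
computes-≼ (≼-▷ p≼q _) p∋f with computes-≼ p≼q p∋f
... | r , r≡f = suc r , r≡f

record Extension {i k} (p : Prog i k) (d : ℕ) (f : Vec ℕ i → ℕ) : Set where
  constructor extension
  field
    {size}   : ℕ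
    prog     : Prog i size
    extends  : p ≼[ d ] prog
    result   : prog computes f

count : ∀ {i k} n {p : Prog i k} → p computes (λ _ → 2) → Extension p (suc ⌊ n /2⌋) (λ _ → n)
count zero          {p} _ = extension (p ▷ nought) (≼-▷ ≼-refl nought) (zero , λ _ → refl)
count (suc zero)    {p} _ = extension (p ▷ one) (≼-▷ ≼-refl one) (zero , λ _ → refl)
count (suc (suc n)) two with count n two
... | extension q p≼q (r , r≡n) with computes-≼ p≼q two
...   | r₂ , r₂≡2 =
  extension (q ▷ add r₂ r) (≼-▷ p≼q _) (zero , λ v → cong₂ _+_ (r₂≡2 v) (r≡n v))

numeral : ∀ {i k} n (p : Prog i k) → Extension p (suc ⌊ n /2⌋ + 2) (λ _ → n)
numeral n p with count n {p ▷ one ▷ add zero zero} (zero , λ _ → refl)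
... | extension q p₂≼q q∋n = extension q (≼-trans (≼-▷ (≼-▷ ≼-refl one) _) p₂≼q) q∋n

data ℕPoly (d : ℕ) : Set where
  con     : ℕ → ℕPoly d
  var     : Fin d → ℕPoly d
  _⊕_ _⊗_ : ℕPoly d → ℕPoly d → ℕPoly d

evalℕ : ∀ {d} → ℕPoly d → (Fin d → ℕ) → ℕ
evalℕ (con c) ρ = c
evalℕ (var t) ρ = ρ t
evalℕ (P ⊕ Q) ρ = evalℕ P ρ + evalℕ Q ρ
evalℕ (P ⊗ Q) ρ = evalℕ P ρ * evalℕ Q ρ

split : ∀ {d} → Poly d → ℕPoly d × ℕPoly d
split (con (+ c))    = con c , con 0
split (con -[1+ c ]) = con 0 , con (suc c)
split (var t)        = var t , con 0
split (p ⊕ q) = let (p⁺ , p⁻) = split p ; (q⁺ , q⁻) = split q in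
  (p⁺ ⊕ q⁺) , (p⁻ ⊕ q⁻)
split (p ⊗ q) = let (p⁺ , p⁻) = split p ; (q⁺ , q⁻) = split q in
  ((p⁺ ⊗ q⁺) ⊕ (p⁻ ⊗ q⁻)) , ((p⁺ ⊗ q⁻) ⊕ (p⁻ ⊗ q⁺))

lookup-toℤs : ∀ {d} (ρ : Vec ℕ d) t → lookup (toℤs ρ) t ≡ + lookup ρ t
lookup-toℤs (_ ∷ _) zero    = refl
lookup-toℤs (_ ∷ ρ) (suc t) = lookup-toℤs ρ t

eval-split : ∀ {d} (W : Poly d) (ρ : Vec ℕ d) →
  eval W (toℤs ρ) ≡ + evalℕ (proj₁ (split W)) (lookup ρ) ℤ.- + evalℕ (proj₂ (split W)) (lookup ρ)
eval-split (con (+ c))    ρ = sym (ℤ.+-identityʳ (+ c))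
eval-split (con -[1+ c ]) ρ = refl
eval-split (var t)        ρ = trans (lookup-toℤs ρ t) (sym (ℤ.+-identityʳ _))
eval-split (p ⊕ q) ρ = begin
  eval p (toℤs ρ) ℤ.+ eval q (toℤs ρ)
    ≡⟨ cong₂ ℤ._+_ (eval-split p ρ) (eval-split q ρ) ⟩
  (+ A ℤ.- + B) ℤ.+ (+ C ℤ.- + E)
    ≡⟨ difference-+ (+ A) (+ B) (+ C) (+ E) ⟩
  (+ A ℤ.+ + C) ℤ.- (+ B ℤ.+ + E)
    ≡⟨ sym (cong₂ ℤ._-_ (ℤ.pos-+ A C) (ℤ.pos-+ B E)) ⟩
  + (A + C) ℤ.- + (B + E) ∎
  where
  open ≡-Reasoning
  A = evalℕ (proj₁ (split p)) (lookup ρ)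
  B = evalℕ (proj₂ (split p)) (lookup ρ)
  C = evalℕ (proj₁ (split q)) (lookup ρ)
  E = evalℕ (proj₂ (split q)) (lookup ρ)
  difference-+ : ∀ a b c e → (a ℤ.- b) ℤ.+ (c ℤ.- e) ≡ (a ℤ.+ c) ℤ.- (b ℤ.+ e)
  difference-+ = ℤ.solve-∀
eval-split (p ⊗ q) ρ = begin
  eval p (toℤs ρ) ℤ.* eval q (toℤs ρ)
    ≡⟨ cong₂ ℤ._*_ (eval-split p ρ) (eval-split q ρ) ⟩
  (+ A ℤ.- + B) ℤ.* (+ C ℤ.- + E)
    ≡⟨ difference-* (+ A) (+ B) (+ C) (+ E) ⟩
  (+ A ℤ.* + C ℤ.+ + B ℤ.* + E) ℤ.- (+ A ℤ.* + E ℤ.+ + B ℤ.* + C)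
    ≡⟨ sym (cong₂ ℤ._-_ (pos-+* A C B E) (pos-+* A E B C)) ⟩
  + (A * C + B * E) ℤ.- + (A * E + B * C) ∎
  where
  open ≡-Reasoning
  A = evalℕ (proj₁ (split p)) (lookup ρ)
  B = evalℕ (proj₂ (split p)) (lookup ρ)
  C = evalℕ (proj₁ (split q)) (lookup ρ)
  E = evalℕ (proj₂ (split q)) (lookup ρ)
  difference-* : ∀ a b c e →
    (a ℤ.- b) ℤ.* (c ℤ.- e) ≡ (a ℤ.* c ℤ.+ b ℤ.* e) ℤ.- (a ℤ.* e ℤ.+ b ℤ.* c)
  difference-* = ℤ.solve-∀
  pos-+* : ∀ a b c e → + (a * b + c * e) ≡ + a ℤ.* + b ℤ.+ + c ℤ.* + e
  pos-+* a b c e = trans (ℤ.pos-+ (a * b) (c * e)) (cong₂ ℤ._+_ (ℤ.pos-* a b) (ℤ.pos-* c e))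

split-zero⇔ : ∀ {d} (W : Poly d) (ρ : Vec ℕ d) →
  evalℕ (proj₁ (split W)) (lookup ρ) ≡ evalℕ (proj₂ (split W)) (lookup ρ) ⇔ eval W (toℤs ρ) ≡ + 0
split-zero⇔ W ρ = mk⇔
  (λ eq → trans (eval-split W ρ) (ℤ.i≡j⇒i-j≡0 (cong +_ eq)))
  (λ W≡0 → ℤ.+-injective (ℤ.i-j≡0⇒i≡j _ _ (trans (sym (eval-split W ρ)) W≡0)))

cost : ∀ {d} → ℕPoly d → ℕ
cost (con c) = suc ⌊ c /2⌋ + 2
cost (var _) = 0
cost (P ⊕ Q) = suc (cost Q + cost P)
cost (P ⊗ Q) = suc (cost Q + cost P)

compile : ∀ {i k d} (P : ℕPoly d) {f : Fin d → Vec ℕ i → ℕ} (p : Prog i k) →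
  (∀ t → p computes f t) → Extension p (cost P) (λ v → evalℕ P (λ t → f t v))
compile (con c) p _   = numeral c p
compile (var t) p p∋f = extension p ≼-refl (p∋f t)
compile (P ⊕ Q) p p∋f with compile P p p∋f
... | extension q₁ p≼q₁ q₁∋P with compile Q q₁ (computes-≼ p≼q₁ ∘ p∋f)
...   | extension q₂ q₁≼q₂ (r₂ , r₂≡Q) with computes-≼ q₁≼q₂ q₁∋P
...     | r₁ , r₁≡P = extension (q₂ ▷ add r₁ r₂) (≼-▷ (≼-trans p≼q₁ q₁≼q₂) _)
                        (zero , λ v → cong₂ _+_ (r₁≡P v) (r₂≡Q v))
compile (P ⊗ Q) p p∋f with compile P p p∋f
... | extension q₁ p≼q₁ q₁∋P with compile Q q₁ (computes-≼ p≼q₁ ∘ p∋f)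
...   | extension q₂ q₁≼q₂ (r₂ , r₂≡Q) with computes-≼ q₁≼q₂ q₁∋P
...     | r₁ , r₁≡P = extension (q₂ ▷ mul r₁ r₂) (≼-▷ (≼-trans p≼q₁ q₁≼q₂) _)
                        (zero , λ v → cong₂ _*_ (r₁≡P v) (r₂≡Q v))

module GraphSystem (g : ℕ → ℕ) {m : ℕ} (W : Poly (2 + m))
  (graph⇔ : ∀ a → Graph g a ⇔ (∃ λ (x : Vec ℕ m) → SolW W a x)) where

  W⁺ W⁻ : ℕPoly (2 + m)
  W⁺ = proj₁ (split W)
  W⁻ = proj₂ (split W)

  -- The inputs are y ∷ x̄; SolW W (n ∷ []) (y ∷ x̄) says W(n, y, x̄) = 0.
  record Encoding (n K : ℕ) : Set where
    field
      prog      : Prog (suc m) K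
      unit      : prog computes (λ _ → 1)
      successor : prog computes (suc ∘ head)
      positive  : prog computes (λ v → evalℕ W⁺ (lookup (n ∷ v)))
      negative  : prog computes (λ v → evalℕ W⁻ (lookup (n ∷ v)))

  overhead : ℕ
  overhead = 6 + m + cost W⁺ + cost W⁻

  base : Prog (suc m) (3 + m)
  base = start ▷ one ▷ add zero (suc zero)

  start≼base : start ≼[ 2 ] base
  start≼base = ≼-▷ (≼-▷ ≼-refl one) _

  encode : ∀ n → Σ ℕ λ K → Encoding n K × K ≡ ⌊ n /2⌋ + overhead
  encode n = _ , encoding , size≡
    where
    open Extension
    N = numeral n base
    variables : ∀ t → prog N computes (λ v → lookup (n ∷ v) t)
    variables zero    = result N
    variables (suc j) = computes-≼ (≼-trans start≼base (extends N)) (j , λ _ → refl)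
    P = compile W⁺ (prog N) variables
    Q = compile W⁻ (prog P) (computes-≼ (extends P) ∘ variables)
    base≼Q = ≼-trans (≼-trans (extends N) (extends P)) (extends Q)
    encoding : Encoding n (size Q)
    encoding = record
      { prog      = prog Q
      ; unit      = computes-≼ base≼Q (suc zero , λ _ → refl)
      ; successor = computes-≼ base≼Q (zero , λ { (_ ∷ _) → refl })
      ; positive  = computes-≼ (extends Q) (result P)
      ; negative  = result Q
      }
    rearrange : ∀ h p q m → q + (p + (suc h + 2)) + 2 + suc m ≡ h + (6 + m + p + q)
    rearrange = solve-∀
    size≡ : size Q ≡ ⌊ n /2⌋ + overhead
    size≡ = trans (≼-size (≼-trans start≼base base≼Q)) (rearrange ⌊ n /2⌋ (cost W⁺) (cost W⁻) m)

  Encoding-pad : ∀ {n K} d → Encoding n K → Encoding n (d + K)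
  Encoding-pad d e = record
    { prog      = pad d prog
    ; unit      = computes-≼ (≼-pad d prog) unit
    ; successor = computes-≼ (≼-pad d prog) successor
    ; positive  = computes-≼ (≼-pad d prog) positive
    ; negative  = computes-≼ (≼-pad d prog) negative
    }
    where open Encoding e

  Encoding-fit : ∀ {n} → overhead + overhead ≤ n → Encoding n n
  Encoding-fit {n} large with encode n
  ... | K , e , K≡ = subst (Encoding n) (m∸n+n≡m K≤n) (Encoding-pad (n ∸ K) e)
    where
    K≤n : K ≤ n
    K≤n = subst (_≤ n) (sym K≡) (m+m≤o⇒n+n≤o⇒m+n≤o {n = overhead} (⌊n/2⌋+⌊n/2⌋≤n n) large)

  solution⇒graph : ∀ {n y x} → SolW W (n ∷ []) (y ∷ x) → g n ≡ y
  solution⇒graph {n} {y} {x} s = Equivalence.from (graph⇔ (n ∷ y ∷ [])) (x , s)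

  module _ {n N : ℕ} (e : Encoding n N) where
    open Encoding e

    -- E_N has no equation x = y, so W⁺ = W⁻ is written as W⁺ · 1 = W⁻.
    constraint : Eqn N
    constraint = mul (proj₁ positive) (proj₁ unit) (proj₁ negative)

    S : System N
    S = constraint ∷ system prog

    constraint⇔ : ∀ v → SatEq constraint (run prog v) ⇔ SolW W (n ∷ []) v
    constraint⇔ v
      rewrite proj₂ positive v | proj₂ unit v | proj₂ negative v
            | *-identityʳ (evalℕ W⁺ (lookup (n ∷ v)))
      = split-zero⇔ W (n ∷ v)

    S-run : ∀ {w} → Sol S w → w ≡ run prog (initial prog w)
    S-run (_ ∷ ss) = solution⇒run prog ss

    S-input : ∀ {w} → Sol S w → SolW W (n ∷ []) (initial prog w)
    S-input (s ∷ ss) =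
      Equivalence.to (constraint⇔ _) (subst (SatEq constraint) (solution⇒run prog ss) s)

    S-solvable : ∃ λ w → Sol S w
    S-solvable with Equivalence.to (graph⇔ (n ∷ g n ∷ [])) refl
    ... | x , s = run prog (g n ∷ x) , Equivalence.from (constraint⇔ _) s ∷ run-solves prog _

    S-few : ∀ κ → (∀ a → FewerThan κ (SolW {2} {m} W a)) → FewerThan κ (Sol S)
    S-few κ few = FewerThan-comap κ (tail ∘ initial prog)
      (λ w s → solution-tail (S-input s))
      (λ w w′ s s′ eq → begin
        w                           ≡⟨ S-run s ⟩
        run prog (initial prog w)   ≡⟨ cong (run prog) (inputs-injective (S-input s) (S-input s′) eq) ⟩
        run prog (initial prog w′)  ≡⟨ S-run s′ ⟨
        w′ ∎)
      (few (n ∷ g n ∷ []))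
      where
      open ≡-Reasoning
      solution-tail : ∀ {v} → SolW W (n ∷ []) v → SolW W (n ∷ g n ∷ []) (tail v)
      solution-tail {y ∷ x} s = subst (λ y → SolW W (n ∷ y ∷ []) x) (sym (solution⇒graph s)) s
      inputs-injective : ∀ {v v′} → SolW W (n ∷ []) v → SolW W (n ∷ []) v′ → tail v ≡ tail v′ → v ≡ v′
      inputs-injective {_ ∷ _} {_ ∷ _} s s′ eq =
        cong₂ _∷_ (trans (sym (solution⇒graph s)) (solution⇒graph s′)) eq

    S-exceeds : ∀ w → Sol S w → ∃ λ j → lookup w j ≡ suc (g n)
    S-exceeds w s = proj₁ successor , (begin
      lookup w (proj₁ successor)                           ≡⟨ cong (λ u → lookup u (proj₁ successor)) (S-run s) ⟩
      lookup (run prog (initial prog w)) (proj₁ successor) ≡⟨ proj₂ successor (initial prog w) ⟩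
      suc (head (initial prog w))                          ≡⟨ cong suc (head-graph (S-input s)) ⟩
      suc (g n) ∎)
      where
      open ≡-Reasoning
      head-graph : ∀ {v} → SolW W (n ∷ []) v → head v ≡ g n
      head-graph {_ ∷ _} s = sym (solution⇒graph s)

theorem5 : (κ : Kappa) (g : ℕ → ℕ) → KappaFoldRepFun κ g →
    Σ ℕ λ m → (1 ≤ m) × (∀ n → m ≤ n → ∀ b → IsF κ n b → g n < b)
theorem5 κ g (m , W , graph⇔ , few) =
  overhead + overhead , s≤s z≤n , λ n large b (bound , _) →
    let e = Encoding-fit large in
    BoundProp⇒≤ bound (S e) (S-solvable e) (S-few e κ few) (S-exceeds e)
  where open GraphSystem g W graph⇔
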